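{- Let $G=(V,E)$ be a trivalent $2$-edge-connected graph, and let $A\subseteq V$ be an inclusion-minimal cycle, i.e. a cycle containing no proper subset that is a cycle. Then $A$ is a circuit of $M_G$ if and only if $A$ does not disconnect $G$, i.e. the induced subgraph $G[V- A]$ has at most one connected component.
   Context: Graphs are finite and undirected and may have parallel edges; trivalent means every vertex has degree $3$. A set $\{v_1,\dots,v_r\}$ of distinct vertices is a cycle if, after relabeling, $v_i$ and $v_{i+1}$ are adjacent for all $i$, where $v_{r+1}=v_1$. $r^*$ is the rank function of the bond (cographic) matroid of $G$. For $A\subseteq V$, $\delta(A)$ is the set of edges incident to at least one vertex of $A$. The graph curve matroid $M_G$ is the matroid on $V$ whose circuits are the non-empty subsets $A\subseteq V$ that are inclusion-minimal among non-empty subsets satisfying $r^*(\delta(A))\le|A|$. -}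

module Defs where

open import Data.Nat using (ℕ; suc; _≤_)
open import Data.Fin using (Fin; zero; suc; inject₁; fromℕ)
open import Data.Fin.Subset using (Subset; _∈_; _∉_; _⊆_; _⊂_; ∣_∣; ∁; ⊤; Nonempty; ⁅_⁆)
open import Data.Vec using (tabulate; lookup)
open import Data.Bool using (_∨_)
open import Data.Product using (Σ; ∃; _×_; _,_)
open import Data.Sum using (_⊎_)
open import Relation.Binary.PropositionalEquality using (_≡_; _≢_)
open import Relation.Nullary.Decidable using (⌊_⌋)
open import Function.Definitions using (Injective)
open import Function.Bundles using (_⇔_)
import Data.Empty
import Data.Fin as F

-- A finite undirected loopless multigraph: vertices Fin n, edges Fin m,
-- edge e has endpoints src e and tgt e (orientation is irrelevant).
-- Parallel edges are allowed.
record Graph : Set where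
  field
    n        : ℕ
    m        : ℕ
    src      : Fin m → Fin n
    tgt      : Fin m → Fin n
    loopless : ∀ e → src e ≢ tgt e

module _ (G : Graph) where
  open Graph G

  Joins : Fin m → Fin n → Fin n → Set
  Joins e u v = (src e ≡ u × tgt e ≡ v) ⊎ (src e ≡ v × tgt e ≡ u)

  incident : Fin n → Subset m
  incident v = tabulate (λ e → ⌊ src e F.≟ v ⌋ ∨ ⌊ tgt e F.≟ v ⌋)

  -- every vertex has degree 3 (no loops, so degree = number of incident edges)
  Trivalent : Set
  Trivalent = ∀ v → ∣ incident v ∣ ≡ 3

  data Reach (X : Subset m) : Fin n → Fin n → Set where
    here : ∀ {u} → Reach X u u
    step : ∀ {u w v} (e : Fin m) → e ∈ X → Joins e u w → Reach X w v → Reach X u v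

  -- u and v are joined by a walk all of whose vertices lie in S
  -- (i.e. connected in the induced subgraph G[S])
  data ReachIn (S : Subset n) : Fin n → Fin n → Set where
    here : ∀ {u} → u ∈ S → ReachIn S u u
    step : ∀ {u w v} (e : Fin m) → u ∈ S → Joins e u w → ReachIn S w v → ReachIn S u v

  Connected : Set
  Connected = ∀ u v → Reach ⊤ u v

  TwoEdgeConnected : Set
  TwoEdgeConnected = Connected × (∀ e u v → Reach (∁ ⁅ e ⁆) u v)

  -- cycle: distinct vertices v₀..v_k (r = k+1 ≥ 2) and distinct edges
  -- e₀..e_k with e_i joining v_i and v_{i+1}, indices mod r;
  -- A is exactly the set {v₀,…,v_k}.
  IsCycle : Subset n → Set
  IsCycle A = Σ ℕ λ k → 1 ≤ k × Σ (Fin (suc k) → Fin n) λ f → Σ (Fin (suc k) → Fin m) λ g →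
    Injective _≡_ _≡_ f × Injective _≡_ _≡_ g ×
    (∀ (i : Fin k) → Joins (g (inject₁ i)) (f (inject₁ i)) (f (suc i))) ×
    Joins (g (fromℕ k)) (f (fromℕ k)) (f zero) ×
    (∀ v → v ∈ A ⇔ ∃ λ i → f i ≡ v)

  MinimalCycle : Subset n → Set
  MinimalCycle A = IsCycle A × (∀ B → B ⊂ A → ¬C B)
    where ¬C : Subset n → Set
          ¬C B = IsCycle B → Data.Empty.⊥

  δ : Subset n → Subset m
  δ A = tabulate (λ e → lookup A (src e) ∨ lookup A (tgt e))

  -- independent sets of the bond (cographic) matroid: F is independent iff
  -- deleting F does not increase the number of connected components, i.e.
  -- any two vertices connected in G remain connected in G - F
  CoIndependent : Subset m → Set
  CoIndependent I = ∀ u v → Reach ⊤ u v → Reach (∁ I) u v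

  -- r*(F) ≤ k : every bond-matroid-independent subset of F has size ≤ k
  -- (r* = rank function of the bond matroid = max size of independent subset)
  r*≤ : Subset m → ℕ → Set
  r*≤ F k = ∀ I → I ⊆ F → CoIndependent I → ∣ I ∣ ≤ k

  -- circuits of the graph curve matroid M_G
  Satisfies : Subset n → Set
  Satisfies A = r*≤ (δ A) ∣ A ∣

  IsCircuit : Subset n → Set
  IsCircuit A = Nonempty A × Satisfies A ×
    (∀ B → B ⊂ A → Nonempty B → Satisfies B → Data.Empty.⊥)

  DoesNotDisconnect : Subset n → Set
  DoesNotDisconnect A = ∀ u v → u ∉ A → v ∉ A → ReachIn (∁ A) u v

{-# OPTIONS --safe #-}
-- Each vertex of the minimal cycle C has exactly one edge off C, its outer edge. By minimality a
-- chord (a non-cycle edge between cycle vertices) forces C to be a 2-cycle, and then C with the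
-- chord is a theta graph, i.e. all of the connected trivalent graph G. Hence |δ(S)| ≤ |C| + |S|
-- for S ⊆ C. For a coindependent I, a spanning tree of G − I rooted at w gives the vertices other
-- than w distinct parent edges outside I; counting those in δ(S) bounds |I|. This yields
-- r*(δ(C)) ≤ |C|. If G − C is disconnected, descending in the tree from a vertex not connected
-- to the root inside G − C produces one extra parent edge in δ(C − v₀), so C − v₀ satisfies the
-- rank inequality and C is not a circuit. If G − C is connected, then for ∅ ≠ B ⊂ C the outer
-- edges of B plus one cycle edge at B form a coindependent subset of δ(B) of size |B| + 1.

module Submission where

open import Defs

open import Data.Bool using (Bool; true; false; _∨_)
import Data.Bool as Bool
open import Data.Bool.Properties using (T-≡; ∨-zeroʳ)
open import Data.Empty using (⊥-elim)
open import Data.Fin using (Fin; zero; suc; toℕ; inject₁; fromℕ; fromℕ<)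
open import Data.Fin.Properties
  using (any?; toℕ-inject₁; toℕ-fromℕ; toℕ-fromℕ<; toℕ≤pred[n]; toℕ-injective) renaming (_≟_ to _≟ᶠ_)
import Data.Fin.Properties as Finₚ
open import Data.Fin.Subset
open import Data.Fin.Subset.Properties
open import Data.Nat using (ℕ; zero; suc; _+_; _∸_; _≤_; _<_; z≤n; s≤s; _≤?_; _≟_)
open import Data.Nat.Properties
open import Data.Product using (Σ; ∃; _×_; _,_; proj₁; proj₂)
open import Data.Sum using (_⊎_; inj₁; inj₂; [_,_])
open import Data.Vec using (_∷_; []; tabulate; lookup; here; there)
open import Data.Vec.Properties using (lookup∘tabulate; []=⇒lookup; lookup⇒[]=; tabulate-cong; ≡-dec)
open import Function using (_∘_)
open import Function.Bundles using (_⇔_; mk⇔; Equivalence)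
open import Function.Definitions using (Injective)
open import Level using (0ℓ)
open import Relation.Binary.Definitions using (tri<; tri≈; tri>)
open import Relation.Binary.PropositionalEquality hiding ([_])
open import Relation.Nullary using (¬_; Dec; yes; no; contradiction; ¬?)
open import Relation.Nullary.Decidable
  using (⌊_⌋; _×-dec_; _⊎-dec_; toWitness; fromWitness; isYes; does; isYes≗does)
open import Relation.Unary using (Pred; Decidable)

module FiniteSubsets where
  private variable n m : ℕ

  ∈-tabulate⁺ : (h : Fin n → Bool) {x : Fin n} → h x ≡ true → x ∈ tabulate h
  ∈-tabulate⁺ h {x} hx = lookup⇒[]= x _ (trans (lookup∘tabulate h x) hx)

  ∈-tabulate⁻ : (h : Fin n → Bool) {x : Fin n} → x ∈ tabulate h → h x ≡ true
  ∈-tabulate⁻ h {x} x∈ = trans (sym (lookup∘tabulate h x)) ([]=⇒lookup x∈)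

  subset : {P : Pred (Fin n) 0ℓ} → Decidable P → Subset n
  subset P? = tabulate (λ x → ⌊ P? x ⌋)

  module _ {P : Pred (Fin n) 0ℓ} (P? : Decidable P) where

    ∈-subset⁺ : ∀ {x} → P x → x ∈ subset P?
    ∈-subset⁺ {x} px = ∈-tabulate⁺ _ (Equivalence.to T-≡ (fromWitness {a? = P? x} px))

    ∈-subset⁻ : ∀ {x} → x ∈ subset P? → P x
    ∈-subset⁻ {x} x∈ = toWitness {a? = P? x} (Equivalence.from T-≡ (∈-tabulate⁻ _ x∈))

  ∣p∪q∣+∣p∩q∣≡∣p∣+∣q∣ : (p q : Subset n) → ∣ p ∪ q ∣ + ∣ p ∩ q ∣ ≡ ∣ p ∣ + ∣ q ∣
  ∣p∪q∣+∣p∩q∣≡∣p∣+∣q∣ []          []          = refl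
  ∣p∪q∣+∣p∩q∣≡∣p∣+∣q∣ (true ∷ p)  (true ∷ q)  =
    cong suc (trans (+-suc _ _) (trans (cong suc (∣p∪q∣+∣p∩q∣≡∣p∣+∣q∣ p q)) (sym (+-suc _ _))))
  ∣p∪q∣+∣p∩q∣≡∣p∣+∣q∣ (true ∷ p)  (false ∷ q) = cong suc (∣p∪q∣+∣p∩q∣≡∣p∣+∣q∣ p q)
  ∣p∪q∣+∣p∩q∣≡∣p∣+∣q∣ (false ∷ p) (true ∷ q)  =
    trans (cong suc (∣p∪q∣+∣p∩q∣≡∣p∣+∣q∣ p q)) (sym (+-suc _ _))
  ∣p∪q∣+∣p∩q∣≡∣p∣+∣q∣ (false ∷ p) (false ∷ q) = ∣p∪q∣+∣p∩q∣≡∣p∣+∣q∣ p q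

  ∣p∪q∣≤∣p∣+∣q∣ : (p q : Subset n) → ∣ p ∪ q ∣ ≤ ∣ p ∣ + ∣ q ∣
  ∣p∪q∣≤∣p∣+∣q∣ p q = subst (∣ p ∪ q ∣ ≤_) (∣p∪q∣+∣p∩q∣≡∣p∣+∣q∣ p q) (m≤m+n _ _)

  disjoint⇒∣p∣+∣q∣≤∣p∪q∣ : (p q : Subset n) → (∀ {x} → x ∈ p → x ∉ q) → ∣ p ∣ + ∣ q ∣ ≤ ∣ p ∪ q ∣
  disjoint⇒∣p∣+∣q∣≤∣p∪q∣ {n} p q disjoint = ≤-reflexive (begin
    ∣ p ∣ + ∣ q ∣              ≡⟨ ∣p∪q∣+∣p∩q∣≡∣p∣+∣q∣ p q ⟨
    ∣ p ∪ q ∣ + ∣ p ∩ q ∣      ≡⟨ cong (λ r → ∣ p ∪ q ∣ + ∣ r ∣) p∩q≡⊥ ⟩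
    ∣ p ∪ q ∣ + ∣ ⊥ {n} ∣      ≡⟨ cong (∣ p ∪ q ∣ +_) (∣⊥∣≡0 n) ⟩
    ∣ p ∪ q ∣ + 0              ≡⟨ +-identityʳ _ ⟩
    ∣ p ∪ q ∣                  ∎)
    where
    open ≡-Reasoning
    p∩q≡⊥ : p ∩ q ≡ ⊥
    p∩q≡⊥ = Empty-unique λ (x , x∈) → let (x∈p , x∈q) = x∈p∩q⁻ p q x∈ in disjoint x∈p x∈q

  disjoint-⊆⇒∣p∣+∣q∣≤∣r∣ : ∀ {p q r : Subset n} → p ⊆ r → q ⊆ r → (∀ {x} → x ∈ p → x ∉ q) →
                           ∣ p ∣ + ∣ q ∣ ≤ ∣ r ∣
  disjoint-⊆⇒∣p∣+∣q∣≤∣r∣ {p = p} {q} p⊆r q⊆r disjoint =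
    ≤-trans (disjoint⇒∣p∣+∣q∣≤∣p∪q∣ p q disjoint) (p⊆q⇒∣p∣≤∣q∣ (λ x∈ → [ p⊆r , q⊆r ] (x∈p∪q⁻ p q x∈)))

  ∣p∣+∣q∩∁p∣≤∣q∣ : ∀ {p q : Subset n} → p ⊆ q → ∣ p ∣ + ∣ q ∩ ∁ p ∣ ≤ ∣ q ∣
  ∣p∣+∣q∩∁p∣≤∣q∣ {p = p} {q} p⊆q = disjoint-⊆⇒∣p∣+∣q∣≤∣r∣ p⊆q (p∩q⊆p q (∁ p))
    (λ x∈p x∈q∩∁p → x∈∁p⇒x∉p (proj₂ (x∈p∩q⁻ q (∁ p) x∈q∩∁p)) x∈p)

  ∈∧∉⇒≢ : ∀ {p : Subset n} {x y} → x ∈ p → y ∉ p → x ≢ y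
  ∈∧∉⇒≢ x∈ y∉ refl = y∉ x∈

  x∈p-y⁻ : ∀ {p : Subset n} {x y} → x ∈ p - y → x ∈ p × x ≢ y
  x∈p-y⁻ {p = p} {x} {y} x∈ = p─q⊆p p ⁅ y ⁆ x∈ , λ { refl → x∉p-x p x x∈ }
    where
    x∉p-x : ∀ {n} (p : Subset n) x → x ∉ p - x
    x∉p-x (_ ∷ p) (suc x) (there x∈) = x∉p-x p x x∈

  suc∣p-x∣≡∣p∣ : ∀ {p : Subset n} {x} → x ∈ p → suc ∣ p - x ∣ ≡ ∣ p ∣
  suc∣p-x∣≡∣p∣ {p = true ∷ p}  {zero}  here       = cong (λ q → suc ∣ q ∣) (p─⊥≡p p)
  suc∣p-x∣≡∣p∣ {p = true ∷ p}  {suc x} (there x∈) = cong suc (suc∣p-x∣≡∣p∣ x∈)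
  suc∣p-x∣≡∣p∣ {p = false ∷ p} {suc x} (there x∈) = suc∣p-x∣≡∣p∣ x∈

  x∈p⇒0<∣p∣ : ∀ {p : Subset n} {x} → x ∈ p → 0 < ∣ p ∣
  x∈p⇒0<∣p∣ {x = x} x∈ =
    subst (_≤ _) (∣⁅x⁆∣≡1 x) (p⊆q⇒∣p∣≤∣q∣ λ y∈ → subst (_∈ _) (sym (x∈⁅y⁆⇒x≡y x y∈)) x∈)

  ∣p∣≡1⇒singleton : ∀ {p : Subset n} → ∣ p ∣ ≡ 1 → ∃ λ x → x ∈ p × (∀ {y} → y ∈ p → y ≡ x)
  ∣p∣≡1⇒singleton {n} {p} ∣p∣≡1 with nonempty? p
  ... | no  empty   = contradiction (trans (sym (cong ∣_∣ (Empty-unique empty))) ∣p∣≡1)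
                                    (λ ∣⊥∣≡1 → 0≢1+n (trans (sym (∣⊥∣≡0 n)) ∣⊥∣≡1))
  ... | yes (x , x∈) = x , x∈ , unique
    where
    unique : ∀ {y} → y ∈ p → y ≡ x
    unique {y} y∈ with y ≟ᶠ x
    ... | yes y≡x = y≡x
    ... | no  y≢x = contradiction (suc-injective (trans (suc∣p-x∣≡∣p∣ x∈) ∣p∣≡1))
                      (>⇒≢ (x∈p⇒0<∣p∣ (x∈p∧x≢y⇒x∈p-y y∈ y≢x)))

  ⊆∧≢⇒⊂ : ∀ {p q : Subset n} → p ⊆ q → p ≢ q → p ⊂ q
  ⊆∧≢⇒⊂ {p = p} {q} p⊆q p≢q with any? (λ x → (x ∈? q) ×-dec ¬? (x ∈? p))
  ... | yes (x , x∈q , x∉p) = p⊆q , x , x∈q , x∉p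
  ... | no  ∄new            = contradiction (⊆-antisym p⊆q q⊆p) p≢q
    where
    q⊆p : q ⊆ p
    q⊆p {x} x∈q with x ∈? p
    ... | yes x∈p = x∈p
    ... | no  x∉p = contradiction (x , x∈q , x∉p) ∄new

  InjectiveOn : (Fin n → Fin m) → Subset n → Set
  InjectiveOn h S = ∀ {x y} → x ∈ S → y ∈ S → h x ≡ h y → x ≡ y

  injectiveOn⇒∣S∣≤∣T∣ : ∀ (h : Fin n → Fin m) {S T} → InjectiveOn h S →
                        (∀ {x} → x ∈ S → h x ∈ T) → ∣ S ∣ ≤ ∣ T ∣
  injectiveOn⇒∣S∣≤∣T∣ h {[]}        inj into = z≤n
  injectiveOn⇒∣S∣≤∣T∣ h {false ∷ S} inj into =
    injectiveOn⇒∣S∣≤∣T∣ (λ x → h (suc x)) (λ x∈ y∈ eq → Finₚ.suc-injective (inj (there x∈) (there y∈) eq))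
                                         (λ x∈ → into (there x∈))
  injectiveOn⇒∣S∣≤∣T∣ h {true ∷ S} {T} inj into = subst (suc ∣ S ∣ ≤_) (suc∣p-x∣≡∣p∣ (into here))
    (s≤s (injectiveOn⇒∣S∣≤∣T∣ (λ x → h (suc x)) (λ x∈ y∈ eq → Finₚ.suc-injective (inj (there x∈) (there y∈) eq))
           (λ x∈ → x∈p∧x≢y⇒x∈p-y (into (there x∈)) (λ eq → Finₚ.0≢1+n (sym (inj (there x∈) here eq))))))

  injectiveOn⇒∣S∣<∣T∣ : ∀ (h : Fin n → Fin m) {S T t} → InjectiveOn h S →
                        (∀ {x} → x ∈ S → h x ∈ T) → t ∈ T → (∀ {x} → x ∈ S → h x ≢ t) → ∣ S ∣ < ∣ T ∣
  injectiveOn⇒∣S∣<∣T∣ h inj into t∈ missed = subst (_ <_) (suc∣p-x∣≡∣p∣ t∈)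
    (s≤s (injectiveOn⇒∣S∣≤∣T∣ h inj (λ x∈ → x∈p∧x≢y⇒x∈p-y (into x∈) (missed x∈))))

  image : (Fin n → Fin m) → Subset n → Subset m
  image h S = subset (λ y → any? λ x → (x ∈? S) ×-dec (h x ≟ᶠ y))

  image⁺ : ∀ (h : Fin n → Fin m) {S x} → x ∈ S → h x ∈ image h S
  image⁺ h x∈ = ∈-subset⁺ _ (_ , x∈ , refl)

  image⁻ : ∀ (h : Fin n → Fin m) S {y} → y ∈ image h S → ∃ λ x → x ∈ S × h x ≡ y
  image⁻ h S y∈ = ∈-subset⁻ _ y∈

  ∣image∣≤∣S∣ : ∀ (h : Fin n → Fin m) S → ∣ image h S ∣ ≤ ∣ S ∣
  ∣image∣≤∣S∣ {m = m} h [] = ≤-reflexive (trans (cong ∣_∣ (Empty-unique nothing)) (∣⊥∣≡0 m))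
    where
    nothing : Empty (image h [])
    nothing (_ , y∈) with image⁻ h [] y∈
    ... | () , _
  ∣image∣≤∣S∣ h (false ∷ S) = ≤-trans (p⊆q⇒∣p∣≤∣q∣ tail) (∣image∣≤∣S∣ (λ x → h (suc x)) S)
    where
    tail : image h (false ∷ S) ⊆ image (λ x → h (suc x)) S
    tail y∈ with image⁻ h (false ∷ S) y∈
    ... | suc x , there x∈ , refl = image⁺ _ x∈
  ∣image∣≤∣S∣ h (true ∷ S) = ≤-trans (p⊆q⇒∣p∣≤∣q∣ split)
    (≤-trans (∣p∪q∣≤∣p∣+∣q∣ ⁅ h zero ⁆ (image (λ x → h (suc x)) S))
             (subst (λ c → c + ∣ image (λ x → h (suc x)) S ∣ ≤ suc ∣ S ∣) (sym (∣⁅x⁆∣≡1 (h zero)))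
                    (s≤s (∣image∣≤∣S∣ (λ x → h (suc x)) S))))
    where
    split : image h (true ∷ S) ⊆ ⁅ h zero ⁆ ∪ image (λ x → h (suc x)) S
    split y∈ with image⁻ h (true ∷ S) y∈
    ... | zero  , _          , refl = x∈p∪q⁺ (inj₁ (x∈⁅x⁆ (h zero)))
    ... | suc x , there x∈ , refl = x∈p∪q⁺ (inj₂ (image⁺ _ x∈))

open FiniteSubsets

least : (P : ℕ → Set) → (∀ L → Dec (P L)) → ∀ b → P b →
        ∃ λ L → P L × (∀ {L′} → L′ < L → ¬ P L′)
least P P? zero    Pb = zero , Pb , λ ()
least P P? (suc b) Pb with P? zero
... | yes P0 = zero , P0 , λ ()
... | no ¬P0 with least (λ L → P (suc L)) (λ L → P? (suc L)) b Pb
...   | L , PL , below = suc L , PL , λ { {zero} _ → ¬P0 ; {suc L′} (s≤s L′<L) → below L′<L }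

module Walks (G : Graph) where
  open Graph G

  Ends : Fin m → Fin n → Set
  Ends e v = src e ≡ v ⊎ tgt e ≡ v

  Ends? : ∀ v e → Dec (Ends e v)
  Ends? v e = (src e ≟ᶠ v) ⊎-dec (tgt e ≟ᶠ v)

  incident≡subset : ∀ v → incident G v ≡ subset (Ends? v)
  incident≡subset v = tabulate-cong λ e → sym (begin
    isYes (Ends? v e)                                ≡⟨ isYes≗does (Ends? v e) ⟩
    does (src e ≟ᶠ v) ∨ does (tgt e ≟ᶠ v)            ≡⟨ cong₂ _∨_ (isYes≗does (src e ≟ᶠ v)) (isYes≗does (tgt e ≟ᶠ v)) ⟨
    isYes (src e ≟ᶠ v) ∨ isYes (tgt e ≟ᶠ v)          ∎)
    where open ≡-Reasoning

  ∈incident⁺ : ∀ {e v} → Ends e v → e ∈ incident G v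
  ∈incident⁺ {e} {v} ends = subst (e ∈_) (sym (incident≡subset v)) (∈-subset⁺ (Ends? v) ends)

  ∈incident⁻ : ∀ {e v} → e ∈ incident G v → Ends e v
  ∈incident⁻ {e} {v} e∈ = ∈-subset⁻ (Ends? v) (subst (e ∈_) (incident≡subset v) e∈)

  private
    touches : Subset n → Fin m → Bool
    touches S e = lookup S (src e) ∨ lookup S (tgt e)

  ∈δ⁺ : ∀ {S e v} → Ends e v → v ∈ S → e ∈ δ G S
  ∈δ⁺ {S} {e} (inj₁ refl) v∈ = ∈-tabulate⁺ (touches S) (cong (_∨ lookup S (tgt e)) ([]=⇒lookup v∈))
  ∈δ⁺ {S} {e} (inj₂ refl) v∈ =
    ∈-tabulate⁺ (touches S) (trans (cong (lookup S (src e) ∨_) ([]=⇒lookup v∈)) (∨-zeroʳ _))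

  ∈δ⁻ : ∀ {S e} → e ∈ δ G S → ∃ λ v → v ∈ S × Ends e v
  ∈δ⁻ {S} {e} e∈ with lookup S (src e) in eq | ∈-tabulate⁻ (touches S) e∈
  ... | true  | _   = src e , lookup⇒[]= _ S eq , inj₁ refl
  ... | false | eq′ = tgt e , lookup⇒[]= _ S eq′ , inj₂ refl

  δ-mono : ∀ {S T} → S ⊆ T → δ G S ⊆ δ G T
  δ-mono S⊆T e∈ with ∈δ⁻ e∈
  ... | v , v∈ , ends = ∈δ⁺ ends (S⊆T v∈)

  Joins-sym : ∀ {e u v} → Joins G e u v → Joins G e v u
  Joins-sym (inj₁ ends) = inj₂ ends
  Joins-sym (inj₂ ends) = inj₁ ends

  Joins⇒Ends₁ : ∀ {e u v} → Joins G e u v → Ends e u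
  Joins⇒Ends₁ (inj₁ (s≡u , _)) = inj₁ s≡u
  Joins⇒Ends₁ (inj₂ (_ , t≡u)) = inj₂ t≡u

  Joins⇒Ends₂ : ∀ {e u v} → Joins G e u v → Ends e v
  Joins⇒Ends₂ joins = Joins⇒Ends₁ (Joins-sym joins)

  Ends⇒Joins : ∀ {e u} → Ends e u → ∃ λ v → Joins G e u v
  Ends⇒Joins (inj₁ refl) = _ , inj₁ (refl , refl)
  Ends⇒Joins (inj₂ refl) = _ , inj₂ (refl , refl)

  Joins-ends : ∀ {e u v x} → Joins G e u v → Ends e x → x ≡ u ⊎ x ≡ v
  Joins-ends (inj₁ (refl , refl)) (inj₁ refl) = inj₁ refl
  Joins-ends (inj₁ (refl , refl)) (inj₂ refl) = inj₂ refl
  Joins-ends (inj₂ (refl , refl)) (inj₁ refl) = inj₂ refl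
  Joins-ends (inj₂ (refl , refl)) (inj₂ refl) = inj₁ refl

  ends⇒joins : ∀ {e u v} → Ends e u → Ends e v → u ≢ v → Joins G e u v
  ends⇒joins u-end v-end u≢v with Ends⇒Joins u-end
  ... | y , joins with Joins-ends joins v-end
  ...   | inj₁ v≡u  = contradiction (sym v≡u) u≢v
  ...   | inj₂ refl = joins

  Joins⇒≢ : ∀ {e u v} → Joins G e u v → u ≢ v
  Joins⇒≢ {e} (inj₁ (refl , refl)) = loopless e
  Joins⇒≢ {e} (inj₂ (refl , refl)) = loopless e ∘ sym

  data Walk (X : Subset m) (S : Subset n) : Fin n → Fin n → Set where
    here : ∀ {u} → u ∈ S → Walk X S u u
    step : ∀ {u w v} e → e ∈ X → u ∈ S → Joins G e u w → Walk X S w v → Walk X S u v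

  walk-start : ∀ {X S u v} → Walk X S u v → u ∈ S
  walk-start (here u∈)           = u∈
  walk-start (step _ _ u∈ _ _)   = u∈

  walk-++ : ∀ {X S u v w} → Walk X S u v → Walk X S v w → Walk X S u w
  walk-++ (here _)                  q = q
  walk-++ (step e e∈ u∈ joins p)    q = step e e∈ u∈ joins (walk-++ p q)

  walk-reverse : ∀ {X S u v} → Walk X S u v → Walk X S v u
  walk-reverse (here u∈)              = here u∈
  walk-reverse (step e e∈ u∈ joins p) =
    walk-++ (walk-reverse p) (step e e∈ (walk-start p) (Joins-sym joins) (here u∈))

  reach⇒walk : ∀ {X u v} → Reach G X u v → Walk X ⊤ u v
  reach⇒walk here                = here ∈⊤
  reach⇒walk (step e e∈ joins r) = step e e∈ ∈⊤ joins (reach⇒walk r)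

  walk⇒reach : ∀ {X S u v} → Walk X S u v → Reach G X u v
  walk⇒reach (here _)               = here
  walk⇒reach (step e e∈ _ joins p)  = step e e∈ joins (walk⇒reach p)

  walk⇒reachIn : ∀ {X S u v} → Walk X S u v → ReachIn G S u v
  walk⇒reachIn (here u∈)              = here u∈
  walk⇒reachIn (step e _ u∈ joins p)  = step e u∈ joins (walk⇒reachIn p)

  reach-trans : ∀ {X u v w} → Reach G X u v → Reach G X v w → Reach G X u w
  reach-trans r r′ = walk⇒reach (walk-++ (reach⇒walk r) (reach⇒walk r′))

  reach-sym : ∀ {X u v} → Reach G X u v → Reach G X v u
  reach-sym r = walk⇒reach (walk-reverse (reach⇒walk r))

  reachIn-start : ∀ {S u v} → ReachIn G S u v → u ∈ S
  reachIn-start (here u∈)      = u∈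
  reachIn-start (step _ u∈ _ _) = u∈

  reachIn⇒reach : ∀ {S I u v} → I ⊆ δ G S → ReachIn G (∁ S) u v → Reach G (∁ I) u v
  reachIn⇒reach I⊆δ (here _)             = here
  reachIn⇒reach I⊆δ (step e u∉ joins r) = step e (x∉p⇒x∈∁p e∉I) joins (reachIn⇒reach I⊆δ r)
    where
    e∉I : e ∉ _
    e∉I e∈ with ∈δ⁻ (I⊆δ e∈)
    ... | x , x∈S , ends with Joins-ends joins ends
    ...   | inj₁ refl = x∈∁p⇒x∉p u∉ x∈S
    ...   | inj₂ refl = x∈∁p⇒x∉p (reachIn-start r) x∈S

  module BreadthFirst (X : Subset m) (S : Subset n) (w : Fin n) where

    EdgeInto : Subset n → Fin n → Set
    EdgeInto N x = ∃ λ e → e ∈ X × ((src e ≡ x × tgt e ∈ N) ⊎ (tgt e ≡ x × src e ∈ N))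

    EdgeInto? : ∀ N x → Dec (EdgeInto N x)
    EdgeInto? N x = any? λ e → (e ∈? X) ×-dec
      (((src e ≟ᶠ x) ×-dec (tgt e ∈? N)) ⊎-dec ((tgt e ≟ᶠ x) ×-dec (src e ∈? N)))

    Expand : Subset n → Fin n → Set
    Expand N x = x ∈ N ⊎ (x ∈ S × EdgeInto N x)

    Expand? : ∀ N x → Dec (Expand N x)
    Expand? N x = (x ∈? N) ⊎-dec ((x ∈? S) ×-dec EdgeInto? N x)

    Root : Fin n → Set
    Root x = x ≡ w × x ∈ S

    Root? : ∀ x → Dec (Root x)
    Root? x = (x ≟ᶠ w) ×-dec (x ∈? S)

    layer : ℕ → Subset n
    layer zero    = subset Root?
    layer (suc L) = subset (Expand? (layer L))

    layer-suc : ∀ L → layer L ⊆ layer (suc L)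
    layer-suc L x∈ = ∈-subset⁺ (Expand? (layer L)) (inj₁ x∈)

    layer-+ : ∀ d L → layer L ⊆ layer (d + L)
    layer-+ zero    L x∈ = x∈
    layer-+ (suc d) L x∈ = layer-suc (d + L) (layer-+ d L x∈)

    layer-mono : ∀ {L L′} → L ≤ L′ → layer L ⊆ layer L′
    layer-mono {L} {L′} L≤L′ x∈ = subst (λ i → _ ∈ layer i) (m∸n+n≡m L≤L′) (layer-+ (L′ ∸ L) L x∈)

    layer-sound : ∀ L {x} → x ∈ layer L → Walk X S x w
    layer-sound zero x∈ with ∈-subset⁻ Root? x∈
    ... | refl , w∈ = here w∈
    layer-sound (suc L) x∈ with ∈-subset⁻ (Expand? (layer L)) x∈
    ... | inj₁ x∈L                                   = layer-sound L x∈L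
    ... | inj₂ (x∈S , e , e∈ , inj₁ (refl , y∈L)) = step e e∈ x∈S (inj₁ (refl , refl)) (layer-sound L y∈L)
    ... | inj₂ (x∈S , e , e∈ , inj₂ (refl , y∈L)) = step e e∈ x∈S (inj₂ (refl , refl)) (layer-sound L y∈L)

    layer-complete : ∀ {x} → Walk X S x w → ∃ λ L → x ∈ layer L
    layer-complete (here w∈) = zero , ∈-subset⁺ Root? (refl , w∈)
    layer-complete (step e e∈ x∈S joins p) with layer-complete p
    ... | L , y∈L = suc L , ∈-subset⁺ (Expand? (layer L)) (inj₂ (x∈S , e , e∈ , into joins y∈L))
      where
      into : ∀ {x y} → Joins G e x y → y ∈ layer L → (src e ≡ x × tgt e ∈ layer L) ⊎ (tgt e ≡ x × src e ∈ layer L)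
      into (inj₁ (s≡x , refl)) y∈ = inj₁ (s≡x , y∈)
      into (inj₂ (refl , t≡x)) y∈ = inj₂ (t≡x , y∈)

    layer-grows : ∀ L → (∀ {L′} → L′ < L → layer (suc L′) ≢ layer L′) → L ≤ ∣ layer L ∣
    layer-grows zero    _     = z≤n
    layer-grows (suc L) moves = ≤-trans (s≤s (layer-grows L (moves ∘ m≤n⇒m≤1+n)))
      (p⊂q⇒∣p∣<∣q∣ (⊆∧≢⇒⊂ (layer-suc L) (moves ≤-refl ∘ sym)))
  
    layer-stabilises : ∃ λ L → L ≤ n × layer (suc L) ≡ layer L
    layer-stabilises with any? (λ (i : Fin (suc n)) → ≡-dec Bool._≟_ (layer (suc (toℕ i))) (layer (toℕ i)))
    ... | yes (i , fixed) = toℕ i , toℕ≤pred[n] i , fixed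
    ... | no  moving      = contradiction (layer-grows (suc n) moves) (<⇒≱ (s≤s (∣p∣≤n (layer (suc n)))))
      where
      moves : ∀ {L′} → L′ < suc n → layer (suc L′) ≢ layer L′
      moves {L′} L′<1+n fixed = moving (fromℕ< L′<1+n ,
        subst (λ i → layer (suc i) ≡ layer i) (sym (toℕ-fromℕ< L′<1+n)) fixed)

    layer-fixed : ∀ {L} → layer (suc L) ≡ layer L → ∀ d → layer (d + L) ≡ layer L
    layer-fixed fixed zero    = refl
    layer-fixed fixed (suc d) = trans (cong (λ N → subset (Expand? N)) (layer-fixed fixed d)) fixed

    layer⊆layer-n : ∀ L → layer L ⊆ layer n
    layer⊆layer-n L {x} x∈ with layer-stabilises
    ... | L₀ , L₀≤n , fixed with L ≤? L₀
    ...   | yes L≤L₀ = layer-mono (≤-trans L≤L₀ L₀≤n) x∈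
    ...   | no  L≰L₀ = layer-mono L₀≤n (subst (x ∈_) (layer-fixed fixed (L ∸ L₀))
                         (subst (λ i → x ∈ layer i) (sym (m∸n+n≡m (≰⇒≥ L≰L₀))) x∈))

    walk? : ∀ x → Dec (Walk X S x w)
    walk? x with x ∈? layer n
    ... | yes x∈ = yes (layer-sound n x∈)
    ... | no  x∉ = no λ p → let (L , x∈L) = layer-complete p in x∉ (layer⊆layer-n L x∈L)

  record RootedTree (X : Subset m) (w : Fin n) : Set where
    field
      depth       : Fin n → ℕ
      parent      : Fin n → Fin m
      parent-step : ∀ {x} → x ≢ w → parent x ∈ X × ∃ λ y → Joins G (parent x) x y × depth y < depth x

    parent-ends : ∀ {x} → x ≢ w → Ends (parent x) x
    parent-ends x≢w = Joins⇒Ends₁ (proj₁ (proj₂ (proj₂ (parent-step x≢w))))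

    parent-other-end : ∀ {x y} → x ≢ w → y ≢ x → Ends (parent x) y → depth y < depth x
    parent-other-end x≢w y≢x ends with parent-step x≢w
    ... | _ , _ , joins , below with Joins-ends joins ends
    ...   | inj₁ y≡x  = contradiction y≡x y≢x
    ...   | inj₂ refl = below

    parent-injective : ∀ {x y} → x ≢ w → y ≢ w → parent x ≡ parent y → x ≡ y
    parent-injective {x} {y} x≢w y≢w same with x ≟ᶠ y
    ... | yes x≡y = x≡y
    ... | no  x≢y = contradiction
      (parent-other-end x≢w (x≢y ∘ sym) (subst (λ e → Ends e y) (sym same) (parent-ends y≢w)))
      (<⇒≯ (parent-other-end y≢w x≢y (subst (λ e → Ends e x) same (parent-ends x≢w))))
  
    ∣S∣≤∣D∩X∣ : ∀ {S D} → w ∉ S → (∀ {x} → x ∈ S → parent x ∈ D) → ∣ S ∣ ≤ ∣ D ∩ X ∣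
    ∣S∣≤∣D∩X∣ w∉S into = injectiveOn⇒∣S∣≤∣T∣ parent
      (λ x∈ y∈ → parent-injective (∈∧∉⇒≢ x∈ w∉S) (∈∧∉⇒≢ y∈ w∉S))
      (λ x∈ → x∈p∩q⁺ (into x∈ , proj₁ (parent-step (∈∧∉⇒≢ x∈ w∉S))))

    ∣S∣<∣D∩X∣ : ∀ {S D x} → w ∉ S → (∀ {y} → y ∈ S → parent y ∈ D) → x ∉ S → x ≢ w → parent x ∈ D →
                ∣ S ∣ < ∣ D ∩ X ∣
    ∣S∣<∣D∩X∣ w∉S into x∉S x≢w px∈ = injectiveOn⇒∣S∣<∣T∣ parent
      (λ y∈ z∈ → parent-injective (∈∧∉⇒≢ y∈ w∉S) (∈∧∉⇒≢ z∈ w∉S))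
      (λ y∈ → x∈p∩q⁺ (into y∈ , proj₁ (parent-step (∈∧∉⇒≢ y∈ w∉S))))
      (x∈p∩q⁺ (px∈ , proj₁ (parent-step x≢w)))
      (λ y∈ eq → x∉S (subst (_∈ _) (parent-injective (∈∧∉⇒≢ y∈ w∉S) x≢w eq) y∈))

  -- e₀ is only used as the (junk) parent of the root.
  rootedTree : ∀ {X w} → Fin m → (∀ x → Reach G X x w) → RootedTree X w
  rootedTree {X} {w} e₀ reaches = record { depth = depth ; parent = parent ; parent-step = parent-step }
    where
    open BreadthFirst X ⊤ w

    firstLayer : ∀ x → ∃ λ L → x ∈ layer L × (∀ {L′} → L′ < L → x ∉ layer L′)
    firstLayer x = let (L , x∈L) = layer-complete (reach⇒walk (reaches x)) in
                   least (λ L → x ∈ layer L) (λ L → x ∈? layer L) L x∈L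

    depth : Fin n → ℕ
    depth x = proj₁ (firstLayer x)

    depth≤ : ∀ {x} L → x ∈ layer L → depth x ≤ L
    depth≤ {x} L x∈ with depth x ≤? L
    ... | yes d≤L = d≤L
    ... | no  d≰L = contradiction x∈ (proj₂ (proj₂ (firstLayer x)) (≰⇒> d≰L))

    stepDown : ∀ {x} L → x ∈ layer L → (∀ {L′} → L′ < L → x ∉ layer L′) → x ≢ w →
               ∃ λ e → e ∈ X × ∃ λ y → Joins G e x y × depth y < L
    stepDown zero    x∈ _     x≢w = contradiction (proj₁ (∈-subset⁻ Root? x∈)) x≢w
    stepDown (suc L) x∈ fresh x≢w with ∈-subset⁻ (Expand? (layer L)) x∈
    ... | inj₁ x∈L                              = contradiction x∈L (fresh ≤-refl)
    ... | inj₂ (_ , e , e∈ , inj₁ (refl , y∈)) = e , e∈ , _ , inj₁ (refl , refl) , s≤s (depth≤ L y∈)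
    ... | inj₂ (_ , e , e∈ , inj₂ (refl , y∈)) = e , e∈ , _ , inj₂ (refl , refl) , s≤s (depth≤ L y∈)

    towardRoot : ∀ x → x ≢ w → ∃ λ e → e ∈ X × ∃ λ y → Joins G e x y × depth y < depth x
    towardRoot x = let (L , x∈ , fresh) = firstLayer x in stepDown L x∈ fresh

    parent : Fin n → Fin m
    parent x with x ≟ᶠ w
    ... | yes _   = e₀
    ... | no  x≢w = proj₁ (towardRoot x x≢w)

    parent-step : ∀ {x} → x ≢ w → parent x ∈ X × ∃ λ y → Joins G (parent x) x y × depth y < depth x
    parent-step {x} x≢w with x ≟ᶠ w
    ... | yes x≡w  = contradiction x≡w x≢w
    ... | no  x≢w′ = proj₂ (towardRoot x x≢w′)

private variable k : ℕ

prev : Fin (suc k) → Fin (suc k)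
prev zero    = fromℕ _
prev (suc j) = inject₁ j

inject₁-or-last : ∀ (i : Fin (suc k)) → (∃ λ j → inject₁ j ≡ i) ⊎ i ≡ fromℕ k
inject₁-or-last {zero}  zero    = inj₂ refl
inject₁-or-last {suc k} zero    = inj₁ (zero , refl)
inject₁-or-last {suc k} (suc i) with inject₁-or-last i
... | inj₁ (j , refl) = inj₁ (suc j , refl)
... | inj₂ refl       = inj₂ refl

toℕ-prev : ∀ (x : Fin (suc k)) {t} → toℕ x ≡ suc t → toℕ (prev x) ≡ t
toℕ-prev (suc y) eq = trans (toℕ-inject₁ y) (suc-injective eq)

prev-surjective : ∀ (j : Fin (suc k)) → ∃ λ i → prev i ≡ j
prev-surjective j with inject₁-or-last j
... | inj₁ (j′ , refl) = suc j′ , refl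
... | inj₂ refl        = zero , refl

prev≢ : 1 ≤ k → ∀ (i : Fin (suc k)) → prev i ≢ i
prev≢ {suc k} _ zero    ()
prev≢ {suc k} _ (suc j) eq = 1+n≢n (sym (trans (sym (toℕ-inject₁ j)) (cong toℕ eq)))

snoc : ∀ {A : Set} → (Fin k → A) → A → Fin (suc k) → A
snoc {zero}  h a zero    = a
snoc {suc k} h a zero    = h zero
snoc {suc k} h a (suc i) = snoc (h ∘ suc) a i

snoc-inject₁ : ∀ {A : Set} (h : Fin k → A) a i → snoc h a (inject₁ i) ≡ h i
snoc-inject₁ {suc k} h a zero    = refl
snoc-inject₁ {suc k} h a (suc i) = snoc-inject₁ (h ∘ suc) a i

snoc-last : ∀ {A : Set} (h : Fin k → A) a → snoc h a (fromℕ k) ≡ a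
snoc-last {zero}  h a = refl
snoc-last {suc k} h a = snoc-last (h ∘ suc) a

snoc-injective : ∀ {A : Set} {h : Fin k → A} {a} → Injective _≡_ _≡_ h → (∀ i → h i ≢ a) →
                 Injective _≡_ _≡_ (snoc h a)
snoc-injective {k} {h = h} {a} h-inj a-new {x} {y} eq
  with inject₁-or-last x | inject₁-or-last y
... | inj₁ (i , refl) | inj₁ (j , refl) =
  cong inject₁ (h-inj (trans (sym (snoc-inject₁ h a i)) (trans eq (snoc-inject₁ h a j))))
... | inj₁ (i , refl) | inj₂ refl = ⊥-elim (a-new i (trans (sym (snoc-inject₁ h a i)) (trans eq (snoc-last h a))))
... | inj₂ refl | inj₁ (j , refl) = ⊥-elim (a-new j (trans (sym (snoc-inject₁ h a j)) (trans (sym eq) (snoc-last h a))))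
... | inj₂ refl | inj₂ refl = refl

module _ (G : Graph) where
  open Graph G
  open Walks G

  path-reach : ∀ {k X} (h : Fin (suc k) → Fin n) (e : Fin k → Fin m) →
    (∀ j → Joins G (e j) (h (inject₁ j)) (h (suc j))) →
    ∀ {a b} → toℕ a ≤ toℕ b → (∀ j → toℕ a ≤ toℕ j → toℕ j < toℕ b → e j ∈ X) → Reach G X (h a) (h b)
  path-reach h e joins {zero}  {zero}  _ _  = here
  path-reach {suc k} h e joins {zero}  {suc b} _ inX =
    step (e zero) (inX zero z≤n (s≤s z≤n)) (joins zero)
      (path-reach (h ∘ suc) (e ∘ suc) (joins ∘ suc) {zero} {b} z≤n (λ j _ j<b → inX (suc j) z≤n (s≤s j<b)))
  path-reach {suc k} h e joins {suc a} {suc b} (s≤s a≤b) inX =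
    path-reach (h ∘ suc) (e ∘ suc) (joins ∘ suc) a≤b (λ j a≤j j<b → inX (suc j) (s≤s a≤j) (s≤s j<b))

  record CycleOn (k : ℕ) : Set where
    field
      1≤k              : 1 ≤ k
      vertex           : Fin (suc k) → Fin n
      edge             : Fin (suc k) → Fin m
      vertex-injective : Injective _≡_ _≡_ vertex
      edge-injective   : Injective _≡_ _≡_ edge
      joins            : ∀ (i : Fin k) → Joins G (edge (inject₁ i)) (vertex (inject₁ i)) (vertex (suc i))
      joins-last       : Joins G (edge (fromℕ k)) (vertex (fromℕ k)) (vertex zero)

    isCycle : ∀ {B} → (∀ v → v ∈ B ⇔ ∃ λ i → vertex i ≡ v) → IsCycle G B
    isCycle B⇔ = k , 1≤k , vertex , edge , vertex-injective , edge-injective , joins , joins-last , B⇔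

    vertices : Subset n
    vertices = image vertex ⊤

    vertex∈vertices : ∀ i → vertex i ∈ vertices
    vertex∈vertices i = image⁺ vertex ∈⊤

    ∈vertices⁻ : ∀ {v} → v ∈ vertices → ∃ λ i → vertex i ≡ v
    ∈vertices⁻ v∈ = let (i , _ , eq) = image⁻ vertex ⊤ v∈ in i , eq

    isCycle-vertices : IsCycle G vertices
    isCycle-vertices = isCycle λ v → mk⇔ ∈vertices⁻ λ { (i , refl) → vertex∈vertices i }

    edge-before : ∀ i → Joins G (edge (prev i)) (vertex (prev i)) (vertex i)
    edge-before zero    = joins-last
    edge-before (suc i) = joins i

    CycleEdge : Fin m → Set
    CycleEdge e = ∃ λ j → edge j ≡ e

    CycleEdge? : ∀ e → Dec (CycleEdge e)
    CycleEdge? e = any? λ j → edge j ≟ᶠ e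

    cycleEdge-ends : ∀ {e u} → CycleEdge e → Ends e u → u ∈ vertices
    cycleEdge-ends (j , refl) ends with prev-surjective j
    ... | i , refl with Joins-ends (edge-before i) ends
    ...   | inj₁ refl = vertex∈vertices (prev i)
    ...   | inj₂ refl = vertex∈vertices i

    cycleEdges-at : ∀ {j i} → Ends (edge j) (vertex i) → j ≡ i ⊎ j ≡ prev i
    cycleEdges-at {j} {i} ends with prev-surjective j
    ... | i′ , refl with Joins-ends (edge-before i′) ends
    ...   | inj₁ eq = inj₁ (sym (vertex-injective eq))
    ...   | inj₂ eq = inj₂ (cong prev (sym (vertex-injective eq)))

    edge-after-ends : ∀ i → Ends (edge i) (vertex i)
    edge-after-ends i with prev-surjective i
    ... | i′ , refl = Joins⇒Ends₁ (edge-before i′)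

    cycle-reach : ∀ {X} i₀ → (∀ j → j ≢ i₀ → edge j ∈ X) → ∀ t → Reach G X (vertex t) (vertex i₀)
    cycle-reach {X} i₀ inX t = around (toℕ t ≤? toℕ i₀)
      where
      along : ∀ {a b} → toℕ a ≤ toℕ b → (∀ j → toℕ a ≤ toℕ j → toℕ j < toℕ b → edge (inject₁ j) ∈ X) →
              Reach G X (vertex a) (vertex b)
      along = path-reach vertex (edge ∘ inject₁) joins
      ≢i₀ : ∀ {j} → toℕ j ≢ toℕ i₀ → j ≢ i₀
      ≢i₀ j≢i₀ = j≢i₀ ∘ cong toℕ
      below-i₀ : ∀ {a} j → a ≤ toℕ j → toℕ j < toℕ i₀ → edge (inject₁ j) ∈ X
      below-i₀ j _ j<i₀ = inX _ (≢i₀ (<⇒≢ (subst (_< _) (sym (toℕ-inject₁ j)) j<i₀)))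
      around : Dec (toℕ t ≤ toℕ i₀) → Reach G X (vertex t) (vertex i₀)
      around (yes t≤i₀) = along t≤i₀ below-i₀
      around (no  t≰i₀) = reach-trans
        (along t≤k (λ j t≤j _ → inX _ (≢i₀ (>⇒≢ (<-≤-trans i₀<t (subst (toℕ t ≤_) (sym (toℕ-inject₁ j)) t≤j))))))
        (step (edge (fromℕ k)) (inX _ (≢i₀ (>⇒≢ (<-≤-trans i₀<t t≤k)))) joins-last (along z≤n below-i₀))
        where
        i₀<t : toℕ i₀ < toℕ t
        i₀<t = ≰⇒> t≰i₀
        t≤k : toℕ t ≤ toℕ (fromℕ k)
        t≤k = subst (toℕ t ≤_) (sym (toℕ-fromℕ k)) (toℕ≤pred[n] t)

  twoCycle : ∀ {a b e₁ e₂} → a ≢ b → e₁ ≢ e₂ → Joins G e₁ a b → Joins G e₂ b a → CycleOn 1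
  twoCycle {a} {b} {e₁} {e₂} a≢b e₁≢e₂ joins₁ joins₂ = record
    { 1≤k = s≤s z≤n ; vertex = pair a b ; edge = pair e₁ e₂
    ; vertex-injective = pair-injective a≢b ; edge-injective = pair-injective e₁≢e₂
    ; joins = λ { zero → joins₁ } ; joins-last = joins₂ }
    where
    pair : ∀ {A : Set} → A → A → Fin 2 → A
    pair x y zero       = x
    pair x y (suc zero) = y
    pair-injective : ∀ {A : Set} {x y : A} → x ≢ y → Injective _≡_ _≡_ (pair x y)
    pair-injective x≢y {zero}     {zero}     _  = refl
    pair-injective x≢y {zero}     {suc zero} eq = ⊥-elim (x≢y eq)
    pair-injective x≢y {suc zero} {zero}     eq = ⊥-elim (x≢y (sym eq))
    pair-injective x≢y {suc zero} {suc zero} _  = refl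

  module Chords {k} (C : CycleOn k) where
    open CycleOn C

    record ShorterCycle : Set where
      field
        {length}  : ℕ
        cycle     : CycleOn length
        within    : ∀ t → ∃ λ i → vertex i ≡ CycleOn.vertex cycle t
        missed    : Fin (suc k)
        misses    : ∀ t → CycleOn.vertex cycle t ≢ vertex missed

    module Arc {e i j} (e∉C : ¬ CycleEdge e) (chord : Joins G e (vertex i) (vertex j))
               (i<j : toℕ i < toℕ j) where

      len : ℕ
      len = toℕ j ∸ toℕ i

      i+len≡j : toℕ i + len ≡ toℕ j
      i+len≡j = m+[n∸m]≡n (<⇒≤ i<j)

      bound : ∀ {t} → t ≤ len → toℕ i + t < suc k
      bound t≤len = s≤s (≤-trans (+-monoʳ-≤ (toℕ i) t≤len) (≤-trans (≤-reflexive i+len≡j) (toℕ≤pred[n] j)))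

      shift : Fin (suc len) → Fin (suc k)
      shift t = fromℕ< (bound (toℕ≤pred[n] t))

      toℕ-shift : ∀ t → toℕ (shift t) ≡ toℕ i + toℕ t
      toℕ-shift t = toℕ-fromℕ< (bound (toℕ≤pred[n] t))

      shift-injective : Injective _≡_ _≡_ shift
      shift-injective {s} {t} eq = toℕ-injective (+-cancelˡ-≡ (toℕ i) _ _
        (trans (sym (toℕ-shift s)) (trans (cong toℕ eq) (toℕ-shift t))))

      prev-shift-suc : ∀ s → prev (shift (suc s)) ≡ shift (inject₁ s)
      prev-shift-suc s = toℕ-injective (begin
        toℕ (prev (shift (suc s)))   ≡⟨ toℕ-prev (shift (suc s)) (trans (toℕ-shift (suc s)) (+-suc (toℕ i) (toℕ s))) ⟩
        toℕ i + toℕ s                ≡⟨ cong (toℕ i +_) (toℕ-inject₁ s) ⟨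
        toℕ i + toℕ (inject₁ s)      ≡⟨ toℕ-shift (inject₁ s) ⟨
        toℕ (shift (inject₁ s))      ∎)
        where open ≡-Reasoning

      pathEdge : Fin len → Fin m
      pathEdge s = edge (shift (inject₁ s))

      pathEdge-joins : ∀ s → Joins G (pathEdge s) (vertex (shift (inject₁ s))) (vertex (shift (suc s)))
      pathEdge-joins s = subst (λ x → Joins G (edge x) (vertex x) (vertex (shift (suc s))))
                               (prev-shift-suc s) (edge-before (shift (suc s)))

      arc : CycleOn len
      arc = record
        { 1≤k              = m<n⇒0<n∸m i<j
        ; vertex           = vertex ∘ shift
        ; edge             = snoc pathEdge e
        ; vertex-injective = shift-injective ∘ vertex-injective
        ; edge-injective   = snoc-injective (Finₚ.inject₁-injective ∘ shift-injective ∘ edge-injective)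
                                            (λ s eq → e∉C (_ , eq))
        ; joins            = λ s → subst (λ x → Joins G x (vertex (shift (inject₁ s))) (vertex (shift (suc s))))
                                         (sym (snoc-inject₁ pathEdge e s)) (pathEdge-joins s)
        ; joins-last       = subst₂ (Joins G _) (cong vertex (sym shift-last)) (cong vertex (sym shift-zero))
                               (subst (λ x → Joins G x (vertex j) (vertex i)) (sym (snoc-last pathEdge e))
                                      (Joins-sym chord))
        }
        where
        shift-last : shift (fromℕ len) ≡ j
        shift-last = toℕ-injective (trans (toℕ-shift (fromℕ len))
                                     (trans (cong (toℕ i +_) (toℕ-fromℕ len)) i+len≡j))
        shift-zero : shift zero ≡ i
        shift-zero = toℕ-injective (trans (toℕ-shift zero) (+-identityʳ (toℕ i)))

      arc-missing : ∀ x → (∀ t → toℕ i + toℕ t ≢ toℕ x) → ShorterCycle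
      arc-missing x avoids = record
        { cycle = arc ; within = λ t → shift t , refl ; missed = x
        ; misses = λ t eq → avoids t (trans (sym (toℕ-shift t)) (cong toℕ (vertex-injective eq))) }

    chord⇒shorterCycle : 2 ≤ k → ∀ {e i j} → ¬ CycleEdge e → Joins G e (vertex i) (vertex j) →
                         toℕ i < toℕ j → ShorterCycle
    chord⇒shorterCycle 2≤k {e} {i} {j} e∉C chord i<j with toℕ i ≟ 0 | toℕ j ≟ k
    ... | no i≢0 | _ = Arc.arc-missing e∉C chord i<j zero (λ t i+t≡0 → i≢0 (m+n≡0⇒m≡0 (toℕ i) i+t≡0))
    ... | yes _  | no j≢k = Arc.arc-missing e∉C chord i<j (fromℕ k) λ t i+t≡k → j≢k (≤-antisym (toℕ≤pred[n] j)
          (begin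
            k                              ≡⟨ toℕ-fromℕ k ⟨
            toℕ (fromℕ k)                  ≡⟨ i+t≡k ⟨
            toℕ i + toℕ t                  ≤⟨ +-monoʳ-≤ (toℕ i) (toℕ≤pred[n] t) ⟩
            toℕ i + Arc.len e∉C chord i<j  ≡⟨ Arc.i+len≡j e∉C chord i<j ⟩
            toℕ j                          ∎))
      where open ≤-Reasoning
    -- here the arc is all of C, but the chord and the closing edge of C form a 2-cycle
    ... | yes i≡0 | yes j≡k = record
      { cycle  = twoCycle last≢first (λ eq → e∉C (_ , eq)) joins-last
                   (subst₂ (Joins G e) (cong vertex i≡zero) (cong vertex j≡last) chord)
      ; within = λ { zero → fromℕ k , refl ; (suc zero) → zero , refl }
      ; missed = second
      ; misses = λ { zero eq → <-irrefl (sym (trans (sym (toℕ-fromℕ k))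
                                                    (trans (cong toℕ (vertex-injective eq)) toℕ-second))) 2≤k
                   ; (suc zero) eq → 0≢1+n (trans (cong toℕ (vertex-injective eq)) toℕ-second) } }
      where
      1<1+k : 1 < suc k
      1<1+k = s≤s (<⇒≤ 2≤k)
      second : Fin (suc k)
      second = fromℕ< 1<1+k
      toℕ-second : toℕ second ≡ 1
      toℕ-second = toℕ-fromℕ< 1<1+k
      i≡zero : i ≡ zero
      i≡zero = toℕ-injective i≡0
      j≡last : j ≡ fromℕ k
      j≡last = toℕ-injective (trans j≡k (sym (toℕ-fromℕ k)))
      last≢first : vertex (fromℕ k) ≢ vertex zero
      last≢first eq = <⇒≢ (≤-trans (s≤s z≤n) 2≤k)
                          (sym (trans (sym (toℕ-fromℕ k)) (cong toℕ (vertex-injective eq))))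

  fromIsCycle : ∀ {A} → IsCycle G A → ∃ λ k → Σ (CycleOn k) λ C → CycleOn.vertices C ≡ A
  fromIsCycle {A} (k , 1≤k , f , g , f-inj , g-inj , joins , joins-last , A⇔) = k , C ,
    ⊆-antisym (λ v∈ → let (i , eq) = CycleOn.∈vertices⁻ C v∈ in Equivalence.from (A⇔ _) (i , eq))
              (λ {v} v∈ → let (i , eq) = Equivalence.to (A⇔ v) v∈ in subst (_∈ _) eq (CycleOn.vertex∈vertices C i))
    where
    C : CycleOn k
    C = record { 1≤k = 1≤k ; vertex = f ; edge = g ; vertex-injective = f-inj ; edge-injective = g-inj
               ; joins = joins ; joins-last = joins-last }

fin2-cover : ∀ {k} → k ≡ 1 → ∀ {i j : Fin (suc k)} → i ≢ j → ∀ x → x ≡ i ⊎ x ≡ j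
fin2-cover refl {zero}     {zero}     i≢j _          = ⊥-elim (i≢j refl)
fin2-cover refl {zero}     {suc zero} _   zero       = inj₁ refl
fin2-cover refl {zero}     {suc zero} _   (suc zero) = inj₂ refl
fin2-cover refl {suc zero} {zero}     _   zero       = inj₂ refl
fin2-cover refl {suc zero} {zero}     _   (suc zero) = inj₁ refl
fin2-cover refl {suc zero} {suc zero} i≢j _          = ⊥-elim (i≢j refl)

module TrivalentCycle (G : Graph) (trivalent : Trivalent G) {k} (C : CycleOn G k) where
  open Graph G
  open Walks G
  open CycleOn C

  OuterEdge : Fin n → Fin m → Set
  OuterEdge v e = e ∈ incident G v × ¬ CycleEdge e

  OuterEdge? : ∀ v e → Dec (OuterEdge v e)
  OuterEdge? v e = (e ∈? incident G v) ×-dec ¬? (CycleEdge? e)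

  otherEdges : Fin (suc k) → Subset m
  otherEdges i = incident G (vertex i) - edge i - edge (prev i)

  ∣otherEdges∣≡1 : ∀ i → ∣ otherEdges i ∣ ≡ 1
  ∣otherEdges∣≡1 i = suc-injective (trans (suc∣p-x∣≡∣p∣ edge-before∈)
                       (suc-injective (trans (suc∣p-x∣≡∣p∣ (∈incident⁺ (edge-after-ends i))) (trivalent (vertex i)))))
    where
    edge-before∈ : edge (prev i) ∈ incident G (vertex i) - edge i
    edge-before∈ = x∈p∧x≢y⇒x∈p-y (∈incident⁺ (Joins⇒Ends₂ (edge-before i))) (prev≢ 1≤k i ∘ edge-injective)

  ∈otherEdges⁺ : ∀ {i e} → OuterEdge (vertex i) e → e ∈ otherEdges i
  ∈otherEdges⁺ {i} (e∈ , e∉C) = x∈p∧x≢y⇒x∈p-y (x∈p∧x≢y⇒x∈p-y e∈ (λ eq → e∉C (i , sym eq))) (λ eq → e∉C (prev i , sym eq))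

  ∈otherEdges⁻ : ∀ {i e} → e ∈ otherEdges i → OuterEdge (vertex i) e
  ∈otherEdges⁻ e∈ with x∈p-y⁻ e∈
  ... | e∈′ , e≢before with x∈p-y⁻ e∈′
  ...   | e∈inc , e≢after = e∈inc , λ { (j , refl) → [ e≢after ∘ cong edge , e≢before ∘ cong edge ]
                                                       (cycleEdges-at (∈incident⁻ e∈inc)) }

  unique-outerEdge : ∀ i → ∃ λ e → OuterEdge (vertex i) e × (∀ {e′} → OuterEdge (vertex i) e′ → e′ ≡ e)
  unique-outerEdge i = let (e , e∈ , unique) = ∣p∣≡1⇒singleton (∣otherEdges∣≡1 i) in
    e , ∈otherEdges⁻ e∈ , unique ∘ ∈otherEdges⁺

  -- for vertices off the cycle the value is junk
  outer : Fin n → Fin m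
  outer v with any? (OuterEdge? v)
  ... | yes (e , _) = e
  ... | no  _       = edge zero

  outer-spec : ∀ i → OuterEdge (vertex i) (outer (vertex i))
  outer-spec i with any? (OuterEdge? (vertex i))
  ... | yes (_ , outerEdge) = outerEdge
  ... | no  none            = ⊥-elim (none (let (e , outerEdge , _) = unique-outerEdge i in e , outerEdge))

  outer-unique : ∀ i {e} → OuterEdge (vertex i) e → e ≡ outer (vertex i)
  outer-unique i outerEdge = let (_ , _ , unique) = unique-outerEdge i in
    trans (unique outerEdge) (sym (unique (outer-spec i)))

  outer-spec∈ : ∀ {v} → v ∈ vertices → OuterEdge v (outer v)
  outer-spec∈ v∈ with ∈vertices⁻ v∈
  ... | i , refl = outer-spec i

  outer-ends : ∀ {v} → v ∈ vertices → Ends (outer v) v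
  outer-ends v∈ = ∈incident⁻ (proj₁ (outer-spec∈ v∈))

  outer-unique∈ : ∀ {v e} → v ∈ vertices → OuterEdge v e → e ≡ outer v
  outer-unique∈ v∈ with ∈vertices⁻ v∈
  ... | i , refl = outer-unique i

  δ⊆cycle∪outer : ∀ {S} → S ⊆ vertices → δ G S ⊆ image edge ⊤ ∪ image outer S
  δ⊆cycle∪outer S⊆C {e} e∈ with ∈δ⁻ e∈
  ... | v , v∈ , ends with CycleEdge? e
  ...   | yes (j , refl) = x∈p∪q⁺ (inj₁ (image⁺ edge ∈⊤))
  ...   | no  e∉C rewrite outer-unique∈ (S⊆C v∈) (∈incident⁺ ends , e∉C) = x∈p∪q⁺ (inj₂ (image⁺ outer v∈))

  ∣δ∣≤1+k+∣outer∣ : ∀ {S} → S ⊆ vertices → ∣ δ G S ∣ ≤ suc k + ∣ image outer S ∣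
  ∣δ∣≤1+k+∣outer∣ {S} S⊆C = begin
    ∣ δ G S ∣                                    ≤⟨ p⊆q⇒∣p∣≤∣q∣ (δ⊆cycle∪outer S⊆C) ⟩
    ∣ image edge ⊤ ∪ image outer S ∣              ≤⟨ ∣p∪q∣≤∣p∣+∣q∣ (image edge ⊤) (image outer S) ⟩
    ∣ image edge ⊤ ∣ + ∣ image outer S ∣          ≤⟨ +-monoˡ-≤ _ (∣image∣≤∣S∣ edge ⊤) ⟩
    ∣ ⊤ {suc k} ∣ + ∣ image outer S ∣             ≡⟨ cong (_+ ∣ image outer S ∣) (∣⊤∣≡n (suc k)) ⟩
    suc k + ∣ image outer S ∣                     ∎
    where open ≤-Reasoning

  1+k≤∣vertices∣ : suc k ≤ ∣ vertices ∣
  1+k≤∣vertices∣ = subst (_≤ ∣ vertices ∣) (∣⊤∣≡n (suc k))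
    (injectiveOn⇒∣S∣≤∣T∣ vertex {S = ⊤} (λ _ _ eq → vertex-injective eq) (λ _ → vertex∈vertices _))

module OnMinimalCycle (G : Graph) (trivalent : Trivalent G) (connected : Connected G) {k} (C : CycleOn G k)
                    (minimal : ∀ B → B ⊂ CycleOn.vertices C → ¬ IsCycle G B) where
  open Graph G
  open Walks G
  open CycleOn C
  open Chords G C
  open TrivalentCycle G trivalent C

  v₀ : Fin n
  v₀ = vertex zero

  no-shorterCycle : ¬ ShorterCycle
  no-shorterCycle c = minimal (CycleOn.vertices cycle)
    (shorter⊆ , vertex missed , vertex∈vertices missed , missed∉) (CycleOn.isCycle-vertices cycle)
    where
    open ShorterCycle c
    shorter⊆ : CycleOn.vertices cycle ⊆ vertices
    shorter⊆ v∈ with CycleOn.∈vertices⁻ cycle v∈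
    ... | t , refl = let (i , eq) = within t in subst (_∈ vertices) eq (vertex∈vertices i)
    missed∉ : vertex missed ∉ CycleOn.vertices cycle
    missed∉ v∈ = let (t , eq) = CycleOn.∈vertices⁻ cycle v∈ in misses t eq

  chord⇒k≡1 : ∀ {e i j} → ¬ CycleEdge e → Joins G e (vertex i) (vertex j) → k ≡ 1
  chord⇒k≡1 {e} {i} {j} e∉C chord with k ≟ 1 | <-cmp (toℕ i) (toℕ j)
  ... | yes k≡1 | _            = k≡1
  ... | no  k≢1 | tri< i<j _ _ = ⊥-elim (no-shorterCycle (chord⇒shorterCycle (≤∧≢⇒< 1≤k (k≢1 ∘ sym)) e∉C chord i<j))
  ... | no  k≢1 | tri> _ _ j<i =
    ⊥-elim (no-shorterCycle (chord⇒shorterCycle (≤∧≢⇒< 1≤k (k≢1 ∘ sym)) e∉C (Joins-sym chord) j<i))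
  ... | no  _   | tri≈ _ i≡j _ = ⊥-elim (Joins⇒≢ chord (cong vertex (toℕ-injective i≡j)))

  -- With k = 1 a chord makes the cycle a theta graph, a connected component of a trivalent graph.
  chord⇒spanning : ∀ {e i j} → ¬ CycleEdge e → Joins G e (vertex i) (vertex j) → ∀ x → x ∈ vertices
  chord⇒spanning {e} {i} {j} e∉C chord x = closed (connected x (vertex zero)) (vertex∈vertices zero)
    where
    chord-at : ∀ t → Ends e (vertex t)
    chord-at t with fin2-cover (chord⇒k≡1 e∉C chord) (Joins⇒≢ chord ∘ cong vertex) t
    ... | inj₁ refl = Joins⇒Ends₁ chord
    ... | inj₂ refl = Joins⇒Ends₂ chord
    step-closed : ∀ {e′ v u} → v ∈ vertices → Ends e′ v → Ends e′ u → u ∈ vertices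
    step-closed {e′} v∈ v-end u-end with CycleEdge? e′
    ... | yes onC = cycleEdge-ends onC u-end
    ... | no  e′∉C with ∈vertices⁻ v∈
    ...   | t , refl with trans (outer-unique t (∈incident⁺ v-end , e′∉C))
                                (sym (outer-unique t (∈incident⁺ (chord-at t) , e∉C)))
    ...     | refl with Joins-ends chord u-end
    ...       | inj₁ refl = vertex∈vertices i
    ...       | inj₂ refl = vertex∈vertices j
    closed : ∀ {x y} → Reach G ⊤ x y → y ∈ vertices → x ∈ vertices
    closed here                 y∈ = y∈
    closed (step _ _ joins r)   y∈ = step-closed (closed r y∈) (Joins⇒Ends₂ joins) (Joins⇒Ends₁ joins)

  outer-leaves : ∀ {x} → x ∉ vertices → ∀ {v y} → v ∈ vertices → Joins G (outer v) v y → y ∉ vertices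
  outer-leaves x∉ v∈ joins y∈ with ∈vertices⁻ v∈ | ∈vertices⁻ y∈
  ... | i , refl | j , refl = x∉ (chord⇒spanning (proj₂ (outer-spec i)) joins _)

  outer-injectiveOn : ∀ {S} → S ⊂ vertices → InjectiveOn outer S
  outer-injectiveOn (S⊆C , z , z∈C , z∉S) {x} {y} x∈ y∈ same with x ≟ᶠ y
  ... | yes x≡y = x≡y
  ... | no  x≢y with ∈vertices⁻ (S⊆C x∈) | ∈vertices⁻ (S⊆C y∈) | ∈vertices⁻ z∈C
  ...   | i , refl | j , refl | t , refl
    with fin2-cover (chord⇒k≡1 (proj₂ (outer-spec i)) chord) (x≢y ∘ cong vertex) t
    where
    chord : Joins G (outer (vertex i)) (vertex i) (vertex j)
    chord = ends⇒joins (outer-ends (vertex∈vertices i))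
                       (subst (λ e → Ends e (vertex j)) (sym same) (outer-ends (vertex∈vertices j))) x≢y
  ...     | inj₁ refl = ⊥-elim (z∉S x∈)
  ...     | inj₂ refl = ⊥-elim (z∉S y∈)

  -- In G − I, rooted at w, the parent edges of S ⊆ V(C) ∖ {w} are distinct edges of δ(C) outside I.
  coindependent-bound : ∀ {I} → I ⊆ δ G vertices → CoIndependent G I → ∀ w {S} → S ⊆ vertices → w ∉ S →
                        image outer vertices ⊆ image outer S → ∣ I ∣ ≤ ∣ vertices ∣
  coindependent-bound {I} I⊆δ coindependent w {S} S⊆C w∉S outer⊆ =
    ≤-trans (+-cancelʳ-≤ ∣ S ∣ ∣ I ∣ (suc k) count) 1+k≤∣vertices∣
    where
    open RootedTree (rootedTree (edge zero) λ x → coindependent x w (connected x w))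
    parent∈δ : ∀ {x} → x ∈ S → parent x ∈ δ G vertices
    parent∈δ x∈ = ∈δ⁺ (parent-ends (∈∧∉⇒≢ x∈ w∉S)) (S⊆C x∈)
    count : ∣ I ∣ + ∣ S ∣ ≤ suc k + ∣ S ∣
    count = begin
      ∣ I ∣ + ∣ S ∣                        ≤⟨ +-monoʳ-≤ ∣ I ∣ (∣S∣≤∣D∩X∣ w∉S parent∈δ) ⟩
      ∣ I ∣ + ∣ δ G vertices ∩ ∁ I ∣        ≤⟨ ∣p∣+∣q∩∁p∣≤∣q∣ I⊆δ ⟩
      ∣ δ G vertices ∣                     ≤⟨ ∣δ∣≤1+k+∣outer∣ ⊆-refl ⟩
      suc k + ∣ image outer vertices ∣      ≤⟨ +-monoʳ-≤ (suc k) (p⊆q⇒∣p∣≤∣q∣ outer⊆) ⟩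
      suc k + ∣ image outer S ∣             ≤⟨ +-monoʳ-≤ (suc k) (∣image∣≤∣S∣ outer S) ⟩
      suc k + ∣ S ∣                         ∎
      where open ≤-Reasoning

  satisfies-vertices : Satisfies G vertices
  satisfies-vertices I I⊆δ coindependent with any? (λ x → ¬? (x ∈? vertices))
  ... | yes (w , w∉C) = coindependent-bound I⊆δ coindependent w ⊆-refl w∉C ⊆-refl
  ... | no  nothing-off = coindependent-bound I⊆δ coindependent v₀ (p─q⊆p vertices ⁅ v₀ ⁆)
                            (λ v∈ → proj₂ (x∈p-y⁻ v∈) refl) outer⊆
    where
    on-cycle : ∀ x → x ∈ vertices
    on-cycle x with x ∈? vertices
    ... | yes x∈ = x∈
    ... | no  x∉ = contradiction (x , x∉) nothing-off
    -- the other end of the outer edge at v₀ is a cycle vertex with the same outer edge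
    outer⊆ : image outer vertices ⊆ image outer (vertices - v₀)
    outer⊆ e∈ with image⁻ outer vertices e∈
    ... | x , x∈ , refl with x ≟ᶠ v₀
    ...   | no  x≢v₀ = image⁺ outer (x∈p∧x≢y⇒x∈p-y x∈ x≢v₀)
    ...   | yes refl with Ends⇒Joins (outer-ends (vertex∈vertices zero))
    ...     | y , joins rewrite outer-unique∈ (on-cycle y) (∈incident⁺ (Joins⇒Ends₂ joins) , proj₂ (outer-spec zero)) =
                image⁺ outer (x∈p∧x≢y⇒x∈p-y (on-cycle y) (Joins⇒≢ joins ∘ sym))

  module OuterCut {B} (B⊂C : B ⊂ vertices) {i₀} (v₀∈B : vertex i₀ ∈ B) where
    B⊆C : B ⊆ vertices
    B⊆C = proj₁ B⊂C

    cut : Subset m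
    cut = image outer B ∪ ⁅ edge i₀ ⁆

    outer∉C : ∀ {x} → x ∈ vertices → ¬ CycleEdge (outer x)
    outer∉C x∈ = proj₂ (outer-spec∈ x∈)

    cycleEdge∈cut : ∀ {j} → edge j ∈ cut → j ≡ i₀
    cycleEdge∈cut e∈ with x∈p∪q⁻ (image outer B) ⁅ edge i₀ ⁆ e∈
    ... | inj₁ e∈outer = let (x , x∈ , eq) = image⁻ outer B e∈outer in ⊥-elim (outer∉C (B⊆C x∈) (_ , sym eq))
    ... | inj₂ e∈edge  = edge-injective (x∈⁅y⁆⇒x≡y _ e∈edge)

    cut⊆δ : cut ⊆ δ G B
    cut⊆δ e∈ with x∈p∪q⁻ (image outer B) ⁅ edge i₀ ⁆ e∈
    ... | inj₁ e∈outer with image⁻ outer B e∈outer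
    ...   | x , x∈ , refl = ∈δ⁺ (outer-ends (B⊆C x∈)) x∈
    cut⊆δ e∈ | inj₂ e∈edge rewrite x∈⁅y⁆⇒x≡y _ e∈edge = ∈δ⁺ (edge-after-ends i₀) v₀∈B

    ∣B∣<∣cut∣ : ∣ B ∣ < ∣ cut ∣
    ∣B∣<∣cut∣ = injectiveOn⇒∣S∣<∣T∣ outer (outer-injectiveOn B⊂C)
      (λ x∈ → x∈p∪q⁺ (inj₁ (image⁺ outer x∈))) (x∈p∪q⁺ (inj₂ (x∈⁅x⁆ _)))
      (λ x∈ eq → outer∉C (B⊆C x∈) (i₀ , sym eq))

    cycle-to-v₀ : ∀ {x} → x ∈ vertices → Reach G (∁ cut) x (vertex i₀)
    cycle-to-v₀ x∈ with ∈vertices⁻ x∈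
    ... | t , refl = cycle-reach i₀ (λ j j≢i₀ → x∉p⇒x∈∁p (j≢i₀ ∘ cycleEdge∈cut)) t

    -- G − V(C) is connected, and joined to the cycle by the outer edge of a vertex z ∉ B
    cut-coindependent : DoesNotDisconnect G vertices → CoIndependent G cut
    cut-coindependent rest-connected u v _ = reach-trans (to-v₀ u) (reach-sym (to-v₀ v))
      where
      z = proj₁ (proj₂ B⊂C)
      z∈C = proj₁ (proj₂ (proj₂ B⊂C))
      z∉B = proj₂ (proj₂ (proj₂ B⊂C))
      to-v₀ : ∀ x → Reach G (∁ cut) x (vertex i₀)
      to-v₀ x with x ∈? vertices
      ... | yes x∈ = cycle-to-v₀ x∈
      ... | no  x∉ with Ends⇒Joins (outer-ends z∈C)
      ...   | y , joins = reach-trans (reachIn⇒reach (δ-mono B⊆C ∘ cut⊆δ) (rest-connected x y x∉ y∉))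
                            (step (outer z) (x∉p⇒x∈∁p outer∉cut) (Joins-sym joins) (cycle-to-v₀ z∈C))
        where
        y∉ : y ∉ vertices
        y∉ = outer-leaves x∉ z∈C joins
        outer∉cut : outer z ∉ cut
        outer∉cut e∈ with x∈p∪q⁻ (image outer B) ⁅ edge i₀ ⁆ e∈
        ... | inj₂ e∈edge  = outer∉C z∈C (i₀ , sym (x∈⁅y⁆⇒x≡y _ e∈edge))
        ... | inj₁ e∈outer with image⁻ outer B e∈outer
        ...   | b , b∈ , same with Joins-ends joins (subst (λ e → Ends e b) same (outer-ends (B⊆C b∈)))
        ...     | inj₁ refl = z∉B b∈
        ...     | inj₂ refl = y∉ (B⊆C b∈)

  nonDisconnecting⇒minimal : DoesNotDisconnect G vertices →
                             ∀ B → B ⊂ vertices → Nonempty B → ¬ Satisfies G B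
  nonDisconnecting⇒minimal rest-connected B B⊂C (b , b∈) satisfies with ∈vertices⁻ (proj₁ B⊂C b∈)
  ... | i₀ , refl = <⇒≱ ∣B∣<∣cut∣ (satisfies cut cut⊆δ (cut-coindependent rest-connected))
    where open OuterCut B⊂C b∈

  exit : ∀ {X u} (T : RootedTree X u) → u ∉ vertices → ∀ {v} → v ∉ vertices → ¬ Walk ⊤ (∁ vertices) v u →
         ∃ λ x → x ∉ vertices - v₀ × x ≢ u × RootedTree.parent T x ∈ δ G (vertices - v₀)
  exit {u = u} T u∉ {v} v∉ v↛u = descend (suc (depth v)) ≤-refl v∉ v↛u
    where
    open RootedTree T

    v₀≢u : v₀ ≢ u
    v₀≢u = ∈∧∉⇒≢ (vertex∈vertices zero) u∉

    off-root : ∀ {x} → x ∉ vertices → ¬ Walk ⊤ (∁ vertices) x u → x ≢ u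
    off-root x∉ x↛u refl = x↛u (here (x∉p⇒x∈∁p x∉))

    -- the tree path enters the cycle at v₀ through its outer edge, so v₀'s own parent edge is a cycle edge
    v₀-exit : ∀ {x} → x ∉ vertices → x ≢ u → Ends (parent x) v₀ → parent v₀ ∈ δ G (vertices - v₀)
    v₀-exit {x} x∉ x≢u v₀-end with CycleEdge? (parent v₀) | proj₂ (parent-step v₀≢u)
    ... | no  p∉C | _ = ⊥-elim (x∉ (subst (_∈ vertices) (parent-injective v₀≢u x≢u parent-v₀≡parent-x)
                                          (vertex∈vertices zero)))
      where
      px∉C : ¬ CycleEdge (parent x)
      px∉C onC = x∉ (cycleEdge-ends onC (parent-ends x≢u))
      parent-v₀≡parent-x : parent v₀ ≡ parent x
      parent-v₀≡parent-x = trans (outer-unique zero (∈incident⁺ (parent-ends v₀≢u) , p∉C))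
                                 (sym (outer-unique zero (∈incident⁺ v₀-end , px∉C)))
    ... | yes onC | y , joins , _ =
      ∈δ⁺ (Joins⇒Ends₂ joins) (x∈p∧x≢y⇒x∈p-y (cycleEdge-ends onC (Joins⇒Ends₂ joins)) (Joins⇒≢ joins ∘ sym))

    descend : ∀ fuel {x} → depth x < fuel → x ∉ vertices → ¬ Walk ⊤ (∁ vertices) x u →
              ∃ λ x → x ∉ vertices - v₀ × x ≢ u × parent x ∈ δ G (vertices - v₀)
    descend (suc fuel) {x} d<fuel x∉ x↛u with proj₂ (parent-step (off-root x∉ x↛u))
    ... | y , joins , dy<dx with y ∈? vertices
    ...   | no  y∉ = descend fuel (<-≤-trans dy<dx (≤-pred d<fuel)) y∉
                       (x↛u ∘ step (parent x) ∈⊤ (x∉p⇒x∈∁p x∉) joins)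
    ...   | yes y∈ with y ≟ᶠ v₀
    ...     | no  y≢v₀ = x , x∉ ∘ proj₁ ∘ x∈p-y⁻ , off-root x∉ x↛u ,
                         ∈δ⁺ (Joins⇒Ends₂ joins) (x∈p∧x≢y⇒x∈p-y y∈ y≢v₀)
    ...     | yes refl = v₀ , (λ v₀∈ → proj₂ (x∈p-y⁻ v₀∈) refl) , v₀≢u ,
                         v₀-exit x∉ (off-root x∉ x↛u) (Joins⇒Ends₂ joins)

  disconnected⇒satisfies : ∀ {u v} → u ∉ vertices → v ∉ vertices → ¬ Walk ⊤ (∁ vertices) v u →
                           Satisfies G (vertices - v₀)
  disconnected⇒satisfies {u} u∉ v∉ v↛u I I⊆δ coindependent =
    ≤-trans (+-cancelʳ-≤ ∣ B ∣ ∣ I ∣ k (≤-pred (subst (_≤ suc k + ∣ B ∣) (+-suc ∣ I ∣ ∣ B ∣) count))) k≤∣B∣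
    where
    B = vertices - v₀
    T = rootedTree (edge zero) λ x → coindependent x u (connected x u)
    open RootedTree T
    u∉B : u ∉ B
    u∉B = u∉ ∘ proj₁ ∘ x∈p-y⁻
    parent∈δ : ∀ {x} → x ∈ B → parent x ∈ δ G B
    parent∈δ x∈ = ∈δ⁺ (parent-ends (∈∧∉⇒≢ x∈ u∉B)) x∈
    k≤∣B∣ : k ≤ ∣ B ∣
    k≤∣B∣ = ≤-pred (≤-trans 1+k≤∣vertices∣ (≤-reflexive (sym (suc∣p-x∣≡∣p∣ (vertex∈vertices zero)))))
    count : ∣ I ∣ + suc ∣ B ∣ ≤ suc k + ∣ B ∣
    count with exit T u∉ v∉ v↛u
    ... | x , x∉B , x≢u , px∈δ = begin
      ∣ I ∣ + suc ∣ B ∣               ≤⟨ +-monoʳ-≤ ∣ I ∣ (∣S∣<∣D∩X∣ u∉B parent∈δ x∉B x≢u px∈δ) ⟩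
      ∣ I ∣ + ∣ δ G B ∩ ∁ I ∣          ≤⟨ ∣p∣+∣q∩∁p∣≤∣q∣ I⊆δ ⟩
      ∣ δ G B ∣                       ≤⟨ ∣δ∣≤1+k+∣outer∣ (p─q⊆p vertices ⁅ v₀ ⁆) ⟩
      suc k + ∣ image outer B ∣        ≤⟨ +-monoʳ-≤ (suc k) (∣image∣≤∣S∣ outer B) ⟩
      suc k + ∣ B ∣                    ∎
      where open ≤-Reasoning

  circuit⇒nonDisconnecting : IsCircuit G vertices → DoesNotDisconnect G vertices
  circuit⇒nonDisconnecting (_ , _ , minimal-circuit) u v u∉ v∉ with BreadthFirst.walk? ⊤ (∁ vertices) u v
  ... | yes v⇝u = walk⇒reachIn (walk-reverse v⇝u)
  ... | no  v↛u = ⊥-elim (minimal-circuit (vertices - v₀) (x∈p⇒p-x⊂p (vertex∈vertices zero))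
                            (vertex (fromℕ k) , x∈p∧x≢y⇒x∈p-y (vertex∈vertices _) last≢first)
                            (disconnected⇒satisfies u∉ v∉ v↛u))
    where
    last≢first : vertex (fromℕ k) ≢ v₀
    last≢first eq = <⇒≢ 1≤k (sym (trans (sym (toℕ-fromℕ k)) (cong toℕ (vertex-injective eq))))

  circuit⇔nonDisconnecting : IsCircuit G vertices ⇔ DoesNotDisconnect G vertices
  circuit⇔nonDisconnecting = mk⇔ circuit⇒nonDisconnecting λ rest-connected →
    (v₀ , vertex∈vertices zero) , satisfies-vertices , nonDisconnecting⇒minimal rest-connected

lemma3p6 : (G : Graph) → Trivalent G → TwoEdgeConnected G →
    (A : Subset (Graph.n G)) → MinimalCycle G A →
    (IsCircuit G A ⇔ DoesNotDisconnect G A)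
lemma3p6 G trivalent (connected , _) A (isCycle , minimal) with fromIsCycle G isCycle
... | _ , C , refl = OnMinimalCycle.circuit⇔nonDisconnecting G trivalent connected C minimal
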